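{- Let $F:\mathbb{N}^2\to\mathbb{R}$ be an admissible rescaling satisfying, for all $n$ and all $0\le k\le n$, $$F(n,k)-F(n,k+1) = F(n,n-k)-F(n,n+1-k),$$ and let $f(n,k) = \bigl(F(n,k)-F(n,k+1)\bigr)/\binom{n}{k}$. Let $G=(X,v)$ be a TU-game with $|X|=n$ and define $Q^*_F(G)=\sum_{S\subseteq X} f(n,|S|)\,v(S)$. If $G$ is self-dual, i.e. $v(S) = v(X)-v(X\setminus S)$ for all $S\subseteq X$, then $Q^*_F(G) = v(X)/2$.
   Context: A TU-game on a finite set $X$ is a function $v:2^X\to\mathbb{R}$ with $v(\emptyset)=0$. A function $F:\mathbb{N}^2\to\mathbb{R}$ is an admissible rescaling if (i) $F(n,k)$ is (weakly) decreasing in $k$ for each fixed $n$, and (ii) $F(n,0)=1$ and $F(n,k)=0$ whenever $k>n$. -}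

module Defs where

open import Level using (Level; _⊔_) renaming (suc to lsuc)
open import Data.Nat using (ℕ; zero; suc)
open import Data.Bool using (true; false)
open import Data.Vec using ([]; _∷_)
open import Data.Fin.Subset using (Subset)
open import Algebra.Bundles using (CommutativeRing)
open import Relation.Binary.Structures using (IsTotalOrder)
open import Relation.Nullary using (¬_)

-- An ordered field (the reals are an instance).
record OrderedField (c ℓ : Level) : Set (lsuc (c ⊔ ℓ)) where
  field
    commutativeRing : CommutativeRing c ℓ
  open CommutativeRing commutativeRing public
  field
    _≤_         : Carrier → Carrier → Set ℓ
    isTotalOrder : IsTotalOrder _≈_ _≤_
    +-mono-≤    : ∀ {x y} z → x ≤ y → (x + z) ≤ (y + z)
    *-nonneg    : ∀ {x y} → 0# ≤ x → 0# ≤ y → 0# ≤ (x * y)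
    0≉1         : ¬ (0# ≈ 1#)
    _⁻¹         : Carrier → Carrier
    ⁻¹-inverse  : ∀ x → ¬ (x ≈ 0#) → (x * (x ⁻¹)) ≈ 1#

  fromℕ : ℕ → Carrier
  fromℕ zero    = 0#
  fromℕ (suc n) = 1# + fromℕ n

  sumSubsets : (n : ℕ) → (Subset n → Carrier) → Carrier
  sumSubsets zero    g = g []
  sumSubsets (suc n) g = sumSubsets n (λ S → g (false ∷ S)) + sumSubsets n (λ S → g (true ∷ S))

module _ {c ℓ : Level} (K : OrderedField c ℓ) where
  open OrderedField K
  open import Data.Nat using (_<_; _∸_; _+_)
  open import Data.Nat.Combinatorics using (_C_)
  open import Data.Fin.Subset using (∣_∣; ⊥; ⊤; ∁)

  record AdmissibleRescaling (F : ℕ → ℕ → Carrier) : Set ℓ where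
    field
      decreasing : ∀ n k → F n (suc k) ≤ F n k
      at-zero    : ∀ n → F n 0 ≈ 1#
      beyond     : ∀ n k → n < k → F n k ≈ 0#

  fRes : (ℕ → ℕ → Carrier) → ℕ → ℕ → Carrier
  fRes F n k = (F n k - F n (suc k)) * (fromℕ (n C k) ⁻¹)

  record TUGame (n : ℕ) : Set (c ⊔ ℓ) where
    field
      v       : Subset n → Carrier
      v-empty : v ⊥ ≈ 0#
  open TUGame public

  Qstar : (ℕ → ℕ → Carrier) → {n : ℕ} → TUGame n → Carrier
  Qstar F {n} G = sumSubsets n (λ S → fRes F n ∣ S ∣ * v G S)

  SelfDual : {n : ℕ} → TUGame n → Set ℓ
  SelfDual {n} G = ∀ (S : Subset n) → v G S ≈ (v G ⊤ - v G (∁ S))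

-- Complementation S ↦ X ∖ S is a bijection on subsets sending |S| to n − |S|, and the
-- hypothesis on F says exactly that f(n, n − k) = f(n, k).  Hence Q*_F(G) is unchanged when
-- v(S) is replaced by v(X ∖ S), and adding the two expressions and using self-duality gives
-- 2 Q*_F(G) = v(X) · Σ_S f(n,|S|).  Grouping subsets by cardinality, the latter sum is
-- Σ_k binom(n,k) f(n,k) = Σ_k (F(n,k) − F(n,k+1)), which telescopes to F(n,0) − F(n,n+1) = 1.
module Submission where

open import Defs
open import Level using (Level)
open import Data.Nat using (ℕ; zero; suc; _≤_; _<_; _∸_; s≤s; z≤n) renaming (_+_ to _+ℕ_)
open import Data.Nat.Properties using (≤-pred; n<1+n; m≤m+n; <-≤-trans; +-∸-assoc)
open import Data.Nat.Combinatorics using (_C_; nCk≡nC[n∸k]; nCk+nC[k+1]≡[n+1]C[k+1]; k>n⇒nCk≡0)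
open import Data.Bool using (true; false)
open import Data.Vec using ([]; _∷_)
open import Data.Fin.Subset using (Subset; ⊤; ∁; ∣_∣)
open import Data.Fin.Subset.Properties using (∣∁p∣≡n∸∣p∣; ∣p∣≤n)
open import Data.Sum using (inj₁; inj₂)
import Relation.Binary.PropositionalEquality as ≡
open import Relation.Binary.Structures using (IsTotalOrder)
open import Relation.Nullary using (¬_)
import Algebra.Properties.CommutativeSemigroup as CommutativeSemigroupProperties
import Algebra.Properties.Group as GroupProperties
import Algebra.Properties.Ring as RingProperties

0<nCk : ∀ {n k} → k ≤ n → 0 < n C k
0<nCk {n} {zero} _ = s≤s z≤n
0<nCk {suc n} {suc k} (s≤s k≤n) =
  ≡.subst (0 <_) (nCk+nC[k+1]≡[n+1]C[k+1] n k) (<-≤-trans (0<nCk k≤n) (m≤m+n _ _))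

module _ {c ℓ : Level} (K : OrderedField c ℓ) where
  open OrderedField K renaming (_≤_ to _≤K_)
  open IsTotalOrder isTotalOrder using (total; antisym; ≤-respˡ-≈; ≤-respʳ-≈)
    renaming (refl to ≤K-refl; trans to ≤K-trans)
  open RingProperties ring using (-1*x≈-x; -‿involutive; -0#≈0#)
  open GroupProperties +-group using (//-rightDividesˡ)
  open CommutativeSemigroupProperties +-commutativeSemigroup using (interchange)
  open CommutativeSemigroupProperties *-commutativeSemigroup using (xy∙z≈xz∙y)
  open import Relation.Binary.Reasoning.Setoid setoid

  x-y+y≈x : ∀ x y → (x - y) + y ≈ x
  x-y+y≈x x y = //-rightDividesˡ y x

  x-y+y-z≈x-z : ∀ x y z → (x - y) + (y - z) ≈ x - z
  x-y+y-z≈x-z x y z = begin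
    (x - y) + (y - z) ≈⟨ +-assoc (x - y) y (- z) ⟨
    ((x - y) + y) - z ≈⟨ +-congʳ (x-y+y≈x x y) ⟩
    x - z             ∎

  x+x≈x*2 : ∀ x → x + x ≈ x * fromℕ 2
  x+x≈x*2 x = begin
    x + x               ≈⟨ +-cong (*-identityʳ x) (*-identityʳ x) ⟨
    x * 1# + x * 1#     ≈⟨ +-congˡ (*-congˡ (+-identityʳ 1#)) ⟨
    x * 1# + x * fromℕ 1 ≈⟨ distribˡ x 1# (fromℕ 1) ⟨
    x * fromℕ 2         ∎

  x*z*z⁻¹≈x : ∀ {z} → ¬ (z ≈ 0#) → ∀ x → x * z * z ⁻¹ ≈ x
  x*z*z⁻¹≈x {z} z≉0 x = begin
    x * z * z ⁻¹   ≈⟨ *-assoc x z (z ⁻¹) ⟩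
    x * (z * z ⁻¹) ≈⟨ *-congˡ (⁻¹-inverse z z≉0) ⟩
    x * 1#         ≈⟨ *-identityʳ x ⟩
    x              ∎

  x*z⁻¹*z≈x : ∀ {z} → ¬ (z ≈ 0#) → ∀ x → x * z ⁻¹ * z ≈ x
  x*z⁻¹*z≈x {z} z≉0 x = trans (xy∙z≈xz∙y x (z ⁻¹) z) (x*z*z⁻¹≈x z≉0 x)

  0≤1 : 0# ≤K 1#
  0≤1 with total 0# 1#
  ... | inj₁ 0≤1# = 0≤1#
  ... | inj₂ 1≤0 = ≤-respʳ-≈ -1*-1≈1 (*-nonneg 0≤-1 0≤-1)
    where
    0≤-1 : 0# ≤K (- 1#)
    0≤-1 = ≤-respˡ-≈ (-‿inverseʳ 1#) (≤-respʳ-≈ (+-identityˡ (- 1#)) (+-mono-≤ (- 1#) 1≤0))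
    -1*-1≈1 : - 1# * - 1# ≈ 1#
    -1*-1≈1 = trans (-1*x≈-x (- 1#)) (-‿involutive 1#)

  0≤fromℕ : ∀ m → 0# ≤K fromℕ m
  1≤fromℕ-suc : ∀ m → 1# ≤K fromℕ (suc m)

  0≤fromℕ zero    = ≤K-refl
  0≤fromℕ (suc m) = ≤K-trans 0≤1 (1≤fromℕ-suc m)

  1≤fromℕ-suc m = ≤-respˡ-≈ (+-identityˡ 1#) (≤-respʳ-≈ (+-comm (fromℕ m) 1#) (+-mono-≤ 1# (0≤fromℕ m)))

  fromℕ-suc≉0 : ∀ m → ¬ (fromℕ (suc m) ≈ 0#)
  fromℕ-suc≉0 m 1+m≈0 = 0≉1 (antisym 0≤1 (≤-respʳ-≈ 1+m≈0 (1≤fromℕ-suc m)))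

  fromℕ-+ : ∀ a b → fromℕ (a +ℕ b) ≈ fromℕ a + fromℕ b
  fromℕ-+ zero    b = sym (+-identityˡ (fromℕ b))
  fromℕ-+ (suc a) b = trans (+-congˡ (fromℕ-+ a b)) (sym (+-assoc 1# (fromℕ a) (fromℕ b)))

  sumBelow : ℕ → (ℕ → Carrier) → Carrier
  sumBelow zero    φ = 0#
  sumBelow (suc m) φ = φ 0 + sumBelow m (λ k → φ (suc k))

  sumBelow-cong : ∀ m {φ ψ} → (∀ {k} → k < m → φ k ≈ ψ k) → sumBelow m φ ≈ sumBelow m ψ
  sumBelow-cong zero    φ≈ψ = refl
  sumBelow-cong (suc m) φ≈ψ = +-cong (φ≈ψ (s≤s z≤n)) (sumBelow-cong m (λ k<m → φ≈ψ (s≤s k<m)))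

  sumBelow-+ : ∀ m φ ψ → sumBelow m (λ k → φ k + ψ k) ≈ sumBelow m φ + sumBelow m ψ
  sumBelow-+ zero    φ ψ = sym (+-identityʳ 0#)
  sumBelow-+ (suc m) φ ψ = trans (+-congˡ (sumBelow-+ m _ _)) (interchange _ _ _ _)

  sumBelow-suc : ∀ m φ → sumBelow (suc m) φ ≈ sumBelow m φ + φ m
  sumBelow-suc zero    φ = trans (+-identityʳ (φ 0)) (sym (+-identityˡ (φ 0)))
  sumBelow-suc (suc m) φ = trans (+-congˡ (sumBelow-suc m _)) (sym (+-assoc _ _ _))

  sumBelow-suc-0 : ∀ m φ → φ m ≈ 0# → sumBelow (suc m) φ ≈ sumBelow m φ
  sumBelow-suc-0 m φ φm≈0 = trans (sumBelow-suc m φ) (trans (+-congˡ φm≈0) (+-identityʳ _))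

  sumBelow-telescope : ∀ m (φ : ℕ → Carrier) → sumBelow m (λ k → φ k - φ (suc k)) ≈ φ 0 - φ m
  sumBelow-telescope zero    φ = sym (-‿inverseʳ (φ 0))
  sumBelow-telescope (suc m) φ = trans (+-congˡ (sumBelow-telescope m (λ k → φ (suc k)))) (x-y+y-z≈x-z _ _ _)

  sumSubsets-cong : ∀ n {g h : Subset n → Carrier} → (∀ S → g S ≈ h S) → sumSubsets n g ≈ sumSubsets n h
  sumSubsets-cong zero    g≈h = g≈h []
  sumSubsets-cong (suc n) g≈h = +-cong (sumSubsets-cong n (λ S → g≈h (false ∷ S))) (sumSubsets-cong n (λ S → g≈h (true ∷ S)))

  sumSubsets-+ : ∀ n (g h : Subset n → Carrier) → sumSubsets n (λ S → g S + h S) ≈ sumSubsets n g + sumSubsets n h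
  sumSubsets-+ zero    g h = refl
  sumSubsets-+ (suc n) g h = trans (+-cong (sumSubsets-+ n _ _) (sumSubsets-+ n _ _)) (interchange _ _ _ _)

  sumSubsets-*ʳ : ∀ n (g : Subset n → Carrier) x → sumSubsets n (λ S → g S * x) ≈ sumSubsets n g * x
  sumSubsets-*ʳ zero    g x = refl
  sumSubsets-*ʳ (suc n) g x = trans (+-cong (sumSubsets-*ʳ n _ x) (sumSubsets-*ʳ n _ x)) (sym (distribʳ x _ _))

  sumSubsets-∁ : ∀ n (g : Subset n → Carrier) → sumSubsets n (λ S → g (∁ S)) ≈ sumSubsets n g
  sumSubsets-∁ zero    g = refl
  sumSubsets-∁ (suc n) g =
    trans (+-cong (sumSubsets-∁ n (λ S → g (true ∷ S))) (sumSubsets-∁ n (λ S → g (false ∷ S)))) (+-comm _ _)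

  binom : ℕ → ℕ → Carrier
  binom n k = fromℕ (n C k)

  binom-pascal : ∀ n k → binom n k + binom n (suc k) ≈ binom (suc n) (suc k)
  binom-pascal n k = trans (sym (fromℕ-+ (n C k) (n C suc k))) (reflexive (≡.cong fromℕ (nCk+nC[k+1]≡[n+1]C[k+1] n k)))

  binom-out-of-range : ∀ n → binom n (suc n) ≈ 0#
  binom-out-of-range n = reflexive (≡.cong fromℕ (k>n⇒nCk≡0 (n<1+n n)))

  binom≉0 : ∀ {n k} → k ≤ n → ¬ (binom n k ≈ 0#)
  binom≉0 {n} {k} k≤n with n C k | 0<nCk k≤n
  ... | suc m | _ = fromℕ-suc≉0 m

  sumSubsets-by-size : ∀ n (φ : ℕ → Carrier) →
    sumSubsets n (λ S → φ ∣ S ∣) ≈ sumBelow (suc n) (λ k → binom n k * φ k)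
  sumSubsets-by-size zero    φ = sym (trans (+-identityʳ _) (trans (*-congʳ (+-identityʳ 1#)) (*-identityˡ (φ 0))))
  sumSubsets-by-size (suc n) φ = begin
    sumSubsets n (λ S → φ ∣ S ∣) + sumSubsets n (λ S → φ (suc ∣ S ∣))
      ≈⟨ +-cong (sumSubsets-by-size n φ) (sumSubsets-by-size n φ′) ⟩
    (binom n 0 * φ 0 + upper) + lower
      ≈⟨ +-assoc _ upper lower ⟩
    binom n 0 * φ 0 + (upper + lower)
      ≈⟨ +-congˡ (+-comm upper lower) ⟩
    binom n 0 * φ 0 + (lower + upper)
      ≈⟨ +-congˡ (+-congˡ upper-extended) ⟨
    binom n 0 * φ 0 + (lower + sumBelow (suc n) (λ k → binom n (suc k) * φ′ k))
      ≈⟨ +-congˡ (sumBelow-+ (suc n) (λ k → binom n k * φ′ k) (λ k → binom n (suc k) * φ′ k)) ⟨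
    binom n 0 * φ 0 + sumBelow (suc n) (λ k → binom n k * φ′ k + binom n (suc k) * φ′ k)
      ≈⟨ +-congˡ (sumBelow-cong (suc n) (λ {k} _ → pascal k)) ⟩
    binom (suc n) 0 * φ 0 + sumBelow (suc n) (λ k → binom (suc n) (suc k) * φ′ k) ∎
    where
    φ′ : ℕ → Carrier
    φ′ k = φ (suc k)
    upper lower : Carrier
    upper = sumBelow n (λ k → binom n (suc k) * φ′ k)
    lower = sumBelow (suc n) (λ k → binom n k * φ′ k)
    upper-extended : sumBelow (suc n) (λ k → binom n (suc k) * φ′ k) ≈ upper
    upper-extended = sumBelow-suc-0 n _ (trans (*-congʳ (binom-out-of-range n)) (zeroˡ (φ′ n)))
    pascal : ∀ k → binom n k * φ′ k + binom n (suc k) * φ′ k ≈ binom (suc n) (suc k) * φ′ k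
    pascal k = trans (sym (distribʳ (φ′ k) _ _)) (*-congʳ (binom-pascal n k))

  sumSubsets-symmetric-∁ : ∀ n (w : ℕ → Carrier) (u : Subset n → Carrier) →
    (∀ {k} → k ≤ n → w (n ∸ k) ≈ w k) →
    sumSubsets n (λ S → w ∣ S ∣ * u (∁ S)) ≈ sumSubsets n (λ S → w ∣ S ∣ * u S)
  sumSubsets-symmetric-∁ n w u w-symmetric = begin
    sumSubsets n (λ S → w ∣ S ∣ * u (∁ S))     ≈⟨ sumSubsets-cong n (λ S → *-congʳ (w∣∁S∣≈w∣S∣ S)) ⟨
    sumSubsets n (λ S → w ∣ ∁ S ∣ * u (∁ S))   ≈⟨ sumSubsets-∁ n (λ S → w ∣ S ∣ * u S) ⟩
    sumSubsets n (λ S → w ∣ S ∣ * u S)         ∎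
    where
    w∣∁S∣≈w∣S∣ : ∀ S → w ∣ ∁ S ∣ ≈ w ∣ S ∣
    w∣∁S∣≈w∣S∣ S = trans (reflexive (≡.cong w (∣∁p∣≡n∸∣p∣ S))) (w-symmetric (∣p∣≤n S))

  module _ (F : ℕ → ℕ → Carrier) where

    sumSubsets-fRes≈1 : AdmissibleRescaling K F → ∀ n → sumSubsets n (λ S → fRes K F n ∣ S ∣) ≈ 1#
    sumSubsets-fRes≈1 admissible n = begin
      sumSubsets n (λ S → fRes K F n ∣ S ∣)             ≈⟨ sumSubsets-by-size n (fRes K F n) ⟩
      sumBelow (suc n) (λ k → binom n k * fRes K F n k)  ≈⟨ sumBelow-cong (suc n) (λ k<1+n → binom*fRes (≤-pred k<1+n)) ⟩
      sumBelow (suc n) (λ k → F n k - F n (suc k))       ≈⟨ sumBelow-telescope (suc n) (F n) ⟩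
      F n 0 - F n (suc n)                                ≈⟨ +-cong (at-zero n) (-‿cong (beyond n (suc n) (n<1+n n))) ⟩
      1# - 0#                                            ≈⟨ +-congˡ -0#≈0# ⟩
      1# + 0#                                            ≈⟨ +-identityʳ 1# ⟩
      1#                                                 ∎
      where
      open AdmissibleRescaling admissible
      binom*fRes : ∀ {k} → k ≤ n → binom n k * fRes K F n k ≈ F n k - F n (suc k)
      binom*fRes {k} k≤n = trans (*-comm _ _) (x*z⁻¹*z≈x (binom≉0 k≤n) _)

    fRes-complement : (∀ n k → k ≤ n → F n k - F n (suc k) ≈ F n (n ∸ k) - F n (suc n ∸ k)) →
      ∀ n {k} → k ≤ n → fRes K F n (n ∸ k) ≈ fRes K F n k
    fRes-complement F-symmetric n {k} k≤n = *-cong Δ[n∸k]≈Δk binom⁻¹[n∸k]≈binom⁻¹k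
      where
      Δ[n∸k]≈Δk : F n (n ∸ k) - F n (suc (n ∸ k)) ≈ F n k - F n (suc k)
      Δ[n∸k]≈Δk = sym (trans (F-symmetric n k k≤n) (reflexive (≡.cong (λ m → F n (n ∸ k) - F n m) (+-∸-assoc 1 k≤n))))
      binom⁻¹[n∸k]≈binom⁻¹k : binom n (n ∸ k) ⁻¹ ≈ binom n k ⁻¹
      binom⁻¹[n∸k]≈binom⁻¹k = reflexive (≡.cong (λ m → fromℕ m ⁻¹) (≡.sym (nCk≡nC[n∸k] k≤n)))

  self-dual-weighted-sum : ∀ n (w : ℕ → Carrier) (G : TUGame K n) → SelfDual K G →
    (∀ {k} → k ≤ n → w (n ∸ k) ≈ w k) →
    sumSubsets n (λ S → w ∣ S ∣ * v G S) + sumSubsets n (λ S → w ∣ S ∣ * v G S) ≈ sumSubsets n (λ S → w ∣ S ∣) * v G ⊤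
  self-dual-weighted-sum n w G self-dual w-symmetric = begin
    Σw·v + Σw·v                                                 ≈⟨ +-congˡ (sumSubsets-symmetric-∁ n w (v G) w-symmetric) ⟨
    Σw·v + sumSubsets n (λ S → w ∣ S ∣ * v G (∁ S))             ≈⟨ sumSubsets-+ n _ _ ⟨
    sumSubsets n (λ S → w ∣ S ∣ * v G S + w ∣ S ∣ * v G (∁ S))  ≈⟨ sumSubsets-cong n (λ S → sym (distribˡ (w ∣ S ∣) _ _)) ⟩
    sumSubsets n (λ S → w ∣ S ∣ * (v G S + v G (∁ S)))          ≈⟨ sumSubsets-cong n (λ S → *-congˡ (v[S]+v[∁S]≈v[X] S)) ⟩
    sumSubsets n (λ S → w ∣ S ∣ * v G ⊤)                        ≈⟨ sumSubsets-*ʳ n _ (v G ⊤) ⟩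
    sumSubsets n (λ S → w ∣ S ∣) * v G ⊤                        ∎
    where
    Σw·v : Carrier
    Σw·v = sumSubsets n (λ S → w ∣ S ∣ * v G S)
    v[S]+v[∁S]≈v[X] : ∀ S → v G S + v G (∁ S) ≈ v G ⊤
    v[S]+v[∁S]≈v[X] S = trans (+-congʳ (self-dual S)) (x-y+y≈x (v G ⊤) (v G (∁ S)))

proposition3p10 : ∀ {c ℓ : Level} (K : OrderedField c ℓ) (F : ℕ → ℕ → OrderedField.Carrier K)
    → AdmissibleRescaling K F
    → (∀ n k → k ≤ n → OrderedField._≈_ K (OrderedField._-_ K (F n k) (F n (suc k))) (OrderedField._-_ K (F n (n ∸ k)) (F n (suc n ∸ k))))
    → (n : ℕ) (G : TUGame K n)
    → SelfDual K G
    → OrderedField._≈_ K (Qstar K F G) (OrderedField._*_ K (v G ⊤) (OrderedField._⁻¹ K (OrderedField.fromℕ K 2)))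
proposition3p10 K F admissible F-symmetric n G self-dual = begin
  Q                       ≈⟨ x*z*z⁻¹≈x K (fromℕ-suc≉0 K 1) Q ⟨
  Q * fromℕ 2 * fromℕ 2 ⁻¹ ≈⟨ *-congʳ 2Q≈v[X] ⟩
  v G ⊤ * fromℕ 2 ⁻¹       ∎
  where
  open OrderedField K
  open import Relation.Binary.Reasoning.Setoid setoid
  Q : Carrier
  Q = Qstar K F G
  2Q≈v[X] : Q * fromℕ 2 ≈ v G ⊤
  2Q≈v[X] = begin
    Q * fromℕ 2                                    ≈⟨ x+x≈x*2 K Q ⟨
    Q + Q                                          ≈⟨ self-dual-weighted-sum K n (fRes K F n) G self-dual (fRes-complement K F F-symmetric n) ⟩
    sumSubsets n (λ S → fRes K F n ∣ S ∣) * v G ⊤  ≈⟨ *-congʳ (sumSubsets-fRes≈1 K F admissible n) ⟩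
    1# * v G ⊤                                     ≈⟨ *-identityˡ (v G ⊤) ⟩
    v G ⊤                                          ∎
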